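{- Let $m>n\ge1$ be coprime, $\lambda\in X$, $\Lambda=x(\lambda)$ and $\alpha=\epsilon_i-\delta_j$. If $\Lambda\in\Pi_{ -\alpha}$, then $\lambda\in X_{ -\alpha}$ unless $\alpha=\epsilon_1-\delta_m$ and $\lambda_n=\lambda'_m=0$.
   Context: $X$: partitions $\lambda=(\lambda_1\ge\dots\ge\lambda_n\ge0)$ with $\lambda_1\le m$, drawn in the grid with rows $\epsilon_1,\dots,\epsilon_n$ (top to bottom) and columns $\delta_1,\dots,\delta_m$, with $\lambda_k$ left-justified boxes in row $\epsilon_{n+1-k}$; $\lambda'_j=|\{k:\lambda_k\ge j\}|$. $X_{ -\alpha}$: those $\lambda$ for which box $\epsilon_i-\delta_j$ (row $\epsilon_i$, column $\delta_j$) is an inner corner (in $\lambda$, and removing it gives a Young diagram). $x(\lambda)=(a_1,\dots,a_n|b_1,\dots,b_m)\in\mathbb Z^{n|m}$ with $a_i=m(n-i)+n\lambda_{n+1-i}$, $b_j=n(j-1)+m\lambda'_j$. $\Pi_{ -\alpha}$ is the set of $(a|b)$ with $a_i-b_j=n-m$. -}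

module Defs where

open import Data.Nat using (ℕ; zero; suc; _+_; _*_; _∸_; _≤_; _<_; _≤?_)
open import Data.Fin using (Fin; toℕ; opposite; _≟_) renaming (_≤_ to _≤ᶠ_)
open import Data.List using (length; filter)
open import Data.Integer using (ℤ; +_; _-_)
open import Data.Product using (_×_)
open import Relation.Binary.PropositionalEquality using (_≡_)
open import Relation.Nullary using (¬_)
open import Data.List using (allFin)

-- A partition λ = (λ_1 ≥ … ≥ λ_n ≥ 0) is a function Fin n → ℕ,
-- where index k : Fin n stands for λ_{toℕ k + 1}.
-- λ ∈ X : weakly decreasing, and λ_1 ≤ m (equivalently every λ_k ≤ m).
record InX (n m : ℕ) (lam : Fin n → ℕ) : Set where
  field
    decreasing : ∀ (k k' : Fin n) → k ≤ᶠ k' → lam k' ≤ lam k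
    bounded    : ∀ (k : Fin n) → lam k ≤ m

-- A set of boxes: S k c means the box in the row holding the part with
-- index k (0-based), column c (1-based, c ≥ 1), is in S.
BoxSet : ℕ → Set₁
BoxSet n = Fin n → ℕ → Set

diagram : {n : ℕ} → (Fin n → ℕ) → BoxSet n
diagram lam k c = (1 ≤ c) × (c ≤ lam k)

IsYoungDiagram : {n : ℕ} → BoxSet n → Set
IsYoungDiagram {n} S = ∀ (k k' : Fin n) (c c' : ℕ) → k' ≤ᶠ k → 1 ≤ c' → c' ≤ c → S k c → S k' c'

removeBox : {n : ℕ} → BoxSet n → Fin n → ℕ → BoxSet n
removeBox S k0 c0 k c = S k c × ¬ ((k ≡ k0) × (c ≡ c0))

-- Row ε_i (i : Fin n, standing for i = toℕ i + 1) holds λ_{n+1-i},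
-- i.e. the part with 0-based index n - 1 - toℕ i = opposite i.
rowPart : {n : ℕ} → Fin n → Fin n
rowPart i = opposite i

-- λ ∈ X_{-α} for α = ε_i - δ_j (i : Fin n ~ i = toℕ i + 1, j : Fin m ~ j = toℕ j + 1):
-- the box (row ε_i, column δ_j) is in λ and removing it yields a Young diagram.
record InXα (n m : ℕ) (i : Fin n) (j : Fin m) (lam : Fin n → ℕ) : Set where
  field
    boxIn        : diagram lam (rowPart i) (suc (toℕ j))
    boxRemovable : IsYoungDiagram (removeBox (diagram lam) (rowPart i) (suc (toℕ j)))

conj : {n : ℕ} → (Fin n → ℕ) → ℕ → ℕ
conj {n} lam j = length (filter (λ k → j ≤? lam k) (allFin n))

-- x(λ) = (a_1,…,a_n | b_1,…,b_m)
-- a_i = m(n-i) + n λ_{n+1-i},  b_j = n(j-1) + m λ'_j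
xa : (n m : ℕ) → (Fin n → ℕ) → Fin n → ℤ
xa n m lam i = + (m * (n ∸ suc (toℕ i)) + n * lam (rowPart i))

xb : (n m : ℕ) → (Fin n → ℕ) → Fin m → ℤ
xb n m lam j = + (n * toℕ j + m * conj lam (suc (toℕ j)))

InΠα : (n m : ℕ) → Fin n → Fin m → (Fin n → ℤ) → (Fin m → ℤ) → Set
InΠα n m i j a b = a i - b j ≡ (+ n) - (+ m)

-- Writing the condition a_i − b_j = n − m out gives
--   m (n − i + 1) + n λ_{n+1−i} = n j + m λ'_j ,
-- so m ∣(n − i + 1) − λ'_j∣ = n ∣j − λ_{n+1−i}∣. By coprimality n divides ∣(n − i + 1) − λ'_j∣ ≤ n,
-- leaving two cases. Either λ'_j = n − i + 1 and λ_{n+1−i} = j: row ε_i ends in column j and no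
-- lower row reaches column j, so the box ε_i − δ_j is an inner corner. Or the difference is n,
-- which forces i = 1, λ'_j = 0, j = m and λ_n = 0.
module Submission where

open import Defs
open import Data.Nat
open import Data.Nat.Properties
open import Data.Nat.Coprimality using (Coprime; coprime-divisor) renaming (sym to coprime-sym)
open import Data.Nat.Divisibility using (_∣_; divides; ∣⇒≤)
open import Data.Nat.Tactic.RingSolver renaming (solve to ℕ-solve)
open import Data.Integer as ℤ using (ℤ; +_)
import Data.Integer.Properties as ℤ
open import Data.Integer.Tactic.RingSolver renaming (solve to ℤ-solve)
open import Data.Fin as Fin using (Fin; toℕ; opposite) renaming (_≤_ to _≤ᶠ_)
open import Data.Fin.Properties using (toℕ<n; toℕ-injective; opposite-prop; opposite-involutive) renaming (≤∧≢⇒< to ≤∧≢⇒<ᶠ)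
open import Data.List using (length; filter; tabulate; allFin; _∷_; [])
open import Data.List.Properties using (length-filter; filter-accept; length-tabulate)
open import Data.Product using (_×_; _,_)
open import Data.Sum as Sum using (_⊎_; inj₁; inj₂)
open import Relation.Nullary using (¬_; yes; no; contradiction)
open import Relation.Unary using (Pred; Decidable)
open import Relation.Binary.PropositionalEquality using (_≡_; refl; sym; trans; cong; cong₂; module ≡-Reasoning)
open import Function using (_∘_; id)

m∣n∧n≤m⇒n≡0⊎n≡m : ∀ {m n} → m ∣ n → n ≤ m → n ≡ 0 ⊎ n ≡ m
m∣n∧n≤m⇒n≡0⊎n≡m {n = zero}  _   _   = inj₁ refl
m∣n∧n≤m⇒n≡0⊎n≡m {n = suc _} m∣n n≤m = inj₂ (≤-antisym n≤m (∣⇒≤ m∣n))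

∣m-n∣≤o : ∀ {m n o} → m ≤ o → n ≤ o → ∣ m - n ∣ ≤ o
∣m-n∣≤o {m} {n} m≤o n≤o = ≤-trans (∣m-n∣≤m⊔n m n) (⊔-lub m≤o n≤o)

∣m-n∣≡o⇒m≡o×n≡0 : ∀ {m n o} → 1 ≤ m → m ≤ o → n ≤ o → ∣ m - n ∣ ≡ o → m ≡ o × n ≡ 0
∣m-n∣≡o⇒m≡o×n≡0 {suc m} {zero}  _ _   _   refl = refl , refl
∣m-n∣≡o⇒m≡o×n≡0 {suc m} {suc n} _ m<o n<o refl =
  contradiction (≤-trans (s≤s (∣m-n∣≤m⊔n m n)) (⊔-lub m<o n<o)) (n≮n _)

m+n≡o+p⇒∣m-p∣≡∣o-n∣ : ∀ {m n o p} → m + n ≡ o + p → ∣ m - p ∣ ≡ ∣ o - n ∣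
m+n≡o+p⇒∣m-p∣≡∣o-n∣ {m} {n} {o} {p} eq = begin
  ∣ m - p ∣             ≡⟨ ∣m+n-m+o∣≡∣n-o∣ n m p ⟨
  ∣ n + m - n + p ∣     ≡⟨ cong₂ ∣_-_∣ (+-comm n m) (+-comm n p) ⟩
  ∣ m + n - p + n ∣     ≡⟨ cong (∣_- p + n ∣) eq ⟩
  ∣ o + p - p + n ∣     ≡⟨ cong (∣_- p + n ∣) (+-comm o p) ⟩
  ∣ p + o - p + n ∣     ≡⟨ ∣m+n-m+o∣≡∣n-o∣ p o n ⟩
  ∣ o - n ∣             ∎
  where open ≡-Reasoning

m*x+n*l≡n*y+m*c⇒m*∣x-c∣≡n*∣y-l∣ : ∀ m n {x l y c} → m * x + n * l ≡ n * y + m * c →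
  m * ∣ x - c ∣ ≡ n * ∣ y - l ∣
m*x+n*l≡n*y+m*c⇒m*∣x-c∣≡n*∣y-l∣ m n {x} {l} {y} {c} eq = begin
  m * ∣ x - c ∣          ≡⟨ *-distribˡ-∣-∣ m x c ⟩
  ∣ m * x - m * c ∣      ≡⟨ m+n≡o+p⇒∣m-p∣≡∣o-n∣ {m * x} {n * l} eq ⟩
  ∣ n * y - n * l ∣      ≡⟨ *-distribˡ-∣-∣ n y l ⟨
  n * ∣ y - l ∣          ∎
  where open ≡-Reasoning

coprime-scaled-distances : ∀ {m n x l y c} → Coprime m n →
  1 ≤ x → x ≤ n → c ≤ n → 1 ≤ y → y ≤ m → l ≤ m →
  m * ∣ x - c ∣ ≡ n * ∣ y - l ∣ →
  (x ≡ c × y ≡ l) ⊎ (x ≡ n × c ≡ 0 × y ≡ m × l ≡ 0)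
coprime-scaled-distances {m} {suc n} {x} {l} {y} {c} cop 1≤x@(s≤s _) x≤n@(s≤s _) c≤n 1≤y y≤m l≤m scaled
  with m∣n∧n≤m⇒n≡0⊎n≡m
         (coprime-divisor (coprime-sym cop) (divides ∣ y - l ∣ (trans scaled (*-comm (suc n) _))))
         (∣m-n∣≤o x≤n c≤n)
... | inj₁ ∣x-c∣≡0 = inj₁ (∣m-n∣≡0⇒m≡n ∣x-c∣≡0 , ∣m-n∣≡0⇒m≡n ∣y-l∣≡0)
  where
  ∣y-l∣≡0 : ∣ y - l ∣ ≡ 0
  ∣y-l∣≡0 = m*n≡0⇒m≡0 ∣ y - l ∣ (suc n) (begin
    ∣ y - l ∣ * suc n   ≡⟨ *-comm ∣ y - l ∣ (suc n) ⟩
    suc n * ∣ y - l ∣   ≡⟨ scaled ⟨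
    m * ∣ x - c ∣       ≡⟨ cong (m *_) ∣x-c∣≡0 ⟩
    m * 0               ≡⟨ *-zeroʳ m ⟩
    0                   ∎)
    where open ≡-Reasoning
... | inj₂ ∣x-c∣≡n with ∣m-n∣≡o⇒m≡o×n≡0 1≤x x≤n c≤n ∣x-c∣≡n
                     | ∣m-n∣≡o⇒m≡o×n≡0 1≤y y≤m l≤m ∣y-l∣≡m
  where
  ∣y-l∣≡m : ∣ y - l ∣ ≡ m
  ∣y-l∣≡m = *-cancelˡ-≡ ∣ y - l ∣ m (suc n) (begin
    suc n * ∣ y - l ∣   ≡⟨ scaled ⟨
    m * ∣ x - c ∣       ≡⟨ cong (m *_) ∣x-c∣≡n ⟩
    m * suc n           ≡⟨ *-comm m (suc n) ⟩
    suc n * m           ∎)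
    where open ≡-Reasoning
... | x≡n , c≡0 | y≡m , l≡0 = inj₂ (x≡n , c≡0 , y≡m , l≡0)

length-filter-tabulate-≥ : ∀ {a p} {A : Set a} {P : Pred A p} (P? : Decidable P) {n} (h : Fin n → A) →
  (∀ {k k'} → k ≤ᶠ k' → P (h k') → P (h k)) →
  ∀ k → P (h k) → suc (toℕ k) ≤ length (filter P? (tabulate h))
length-filter-tabulate-≥ P? {suc n} h P-down Fin.zero Phk
  rewrite filter-accept P? {xs = tabulate (h ∘ Fin.suc)} Phk = s≤s z≤n
length-filter-tabulate-≥ P? {suc n} h P-down (Fin.suc k) Phk
  rewrite filter-accept P? {xs = tabulate (h ∘ Fin.suc)} (P-down z≤n Phk) =
  s≤s (length-filter-tabulate-≥ P? (h ∘ Fin.suc) (λ k≤k' → P-down (s≤s k≤k')) k Phk)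

Antitone : ∀ {n} → (Fin n → ℕ) → Set
Antitone lam = ∀ k k' → k ≤ᶠ k' → lam k' ≤ lam k

conj-≤ : ∀ {n} (lam : Fin n → ℕ) t → conj lam t ≤ n
conj-≤ {n} lam t = ≤-trans (length-filter (λ k → t ≤? lam k) (allFin n)) (≤-reflexive (length-tabulate id))

conj-≥ : ∀ {n} {lam : Fin n → ℕ} → Antitone lam → ∀ {t} k → t ≤ lam k → suc (toℕ k) ≤ conj lam t
conj-≥ {lam = lam} antitone {t} =
  length-filter-tabulate-≥ (λ k → t ≤? lam k) id (λ k≤k' t≤ → ≤-trans t≤ (antitone _ _ k≤k'))

corner-removable : ∀ {n} {lam : Fin n → ℕ} {p c} → Antitone lam →
  lam p ≡ c → conj lam c ≤ suc (toℕ p) → IsYoungDiagram (removeBox (diagram lam) p c)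
corner-removable {lam = lam} {p} {c} antitone lam-p≡c conj≤
  k k' c₁ c' k'≤k 1≤c' c'≤c₁ ((_ , c₁≤lam-k) , not-corner) =
  (1≤c' , ≤-trans c'≤c₁ (≤-trans c₁≤lam-k (antitone k' k k'≤k))) , is-corner⇒⊥
  where
  is-corner⇒⊥ : ¬ ((k' ≡ p) × (c' ≡ c))
  is-corner⇒⊥ (refl , refl) with k Fin.≟ p
  ... | yes refl = not-corner (refl , ≤-antisym (≤-trans c₁≤lam-k (≤-reflexive lam-p≡c)) c'≤c₁)
  ... | no k≢p = n≮n _ (begin-strict
    suc (toℕ p)   <⟨ s≤s (≤∧≢⇒<ᶠ k'≤k (k≢p ∘ sym)) ⟩
    suc (toℕ k)   ≤⟨ conj-≥ antitone k (≤-trans c'≤c₁ c₁≤lam-k) ⟩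
    conj lam c'   ≤⟨ conj≤ ⟩
    suc (toℕ p)   ∎)
    where open ≤-Reasoning

i-j≡k-l⇒i+l≡j+k : ∀ (i j k l : ℤ) → i ℤ.- j ≡ k ℤ.- l → i ℤ.+ l ≡ j ℤ.+ k
i-j≡k-l⇒i+l≡j+k i j k l eq = begin
  i ℤ.+ l                      ≡⟨ ℤ-solve (i ∷ j ∷ l ∷ []) ⟩
  (i ℤ.- j) ℤ.+ (j ℤ.+ l)      ≡⟨ cong (ℤ._+ (j ℤ.+ l)) eq ⟩
  (k ℤ.- l) ℤ.+ (j ℤ.+ l)      ≡⟨ ℤ-solve (k ∷ j ∷ l ∷ []) ⟩
  j ℤ.+ k                      ∎
  where open ≡-Reasoning

m*[1+p]+q≡m*p+q+m : ∀ m p q → m * suc p + q ≡ m * p + q + m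
m*[1+p]+q≡m*p+q+m m p q = ℕ-solve (m ∷ p ∷ q ∷ [])

InΠα⇒balance : ∀ n m (lam : Fin n → ℕ) i j → InΠα n m i j (xa n m lam) (xb n m lam) →
  m * suc (toℕ (opposite i)) + n * lam (opposite i) ≡ n * suc (toℕ j) + m * conj lam (suc (toℕ j))
InΠα⇒balance n m lam i j eq = begin
  m * suc P + n * L          ≡⟨ m*[1+p]+q≡m*p+q+m m P (n * L) ⟩
  m * P + n * L + m          ≡⟨ cong (λ a → m * a + n * L + m) (opposite-prop i) ⟩
  m * (n ∸ suc (toℕ i)) + n * L + m
    ≡⟨ ℤ.+-injective (i-j≡k-l⇒i+l≡j+k (xa n m lam i) (xb n m lam j) (+ n) (+ m) eq) ⟩
  n * J + m * C + n          ≡⟨ m*[1+p]+q≡m*p+q+m n J (m * C) ⟨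
  n * suc J + m * C          ∎
  where
  open ≡-Reasoning
  P L J C : ℕ
  P = toℕ (opposite i)
  L = lam (opposite i)
  J = toℕ j
  C = conj lam (suc J)

suc[opposite]≡n⇒toℕ≡0 : ∀ {n} (i : Fin n) → suc (toℕ (opposite i)) ≡ n → toℕ i ≡ 0
suc[opposite]≡n⇒toℕ≡0 {n} i e = begin
  toℕ i                        ≡⟨ cong toℕ (opposite-involutive i) ⟨
  toℕ (opposite (opposite i))  ≡⟨ opposite-prop (opposite i) ⟩
  n ∸ suc (toℕ (opposite i))   ≡⟨ cong (n ∸_) e ⟩
  n ∸ n                        ≡⟨ n∸n≡0 n ⟩
  0                            ∎
  where open ≡-Reasoning

lemma4p6 : (n m : ℕ) → 1 ≤ n → n < m → Coprime m n →
    (lam : Fin n → ℕ) → InX n m lam →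
    (i : Fin n) (j : Fin m) →
    InΠα n m i j (xa n m lam) (xb n m lam) →
    InXα n m i j lam
      ⊎ ((toℕ i ≡ 0) × (suc (toℕ j) ≡ m) × (∀ (k : Fin n) → suc (toℕ k) ≡ n → lam k ≡ 0) × (conj lam m ≡ 0))
lemma4p6 n m _ _ cop lam inx i j eqΠ =
  Sum.map inner-corner first-row-last-column
    (coprime-scaled-distances cop (s≤s z≤n) (toℕ<n p) (conj-≤ lam _) (s≤s z≤n) (toℕ<n j) (bounded p)
      (m*x+n*l≡n*y+m*c⇒m*∣x-c∣≡n*∣y-l∣ m n (InΠα⇒balance n m lam i j eqΠ)))
  where
  open InX inx
  p : Fin n
  p = opposite i
  inner-corner : suc (toℕ p) ≡ conj lam (suc (toℕ j)) × suc (toℕ j) ≡ lam p → InXα n m i j lam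
  inner-corner (rows≡ , column≡) = record
    { boxIn        = s≤s z≤n , ≤-reflexive column≡
    ; boxRemovable = corner-removable decreasing (sym column≡) (≤-reflexive (sym rows≡))
    }
  first-row-last-column : suc (toℕ p) ≡ n × conj lam (suc (toℕ j)) ≡ 0 × suc (toℕ j) ≡ m × lam p ≡ 0 →
    (toℕ i ≡ 0) × (suc (toℕ j) ≡ m) × (∀ (k : Fin n) → suc (toℕ k) ≡ n → lam k ≡ 0) × (conj lam m ≡ 0)
  first-row-last-column (p-last , conj≡0 , j-last , lam-p≡0) =
    suc[opposite]≡n⇒toℕ≡0 i p-last , j-last ,
    (λ k k-last → trans (cong lam (toℕ-injective (suc-injective (trans k-last (sym p-last))))) lam-p≡0) ,
    trans (cong (conj lam) (sym j-last)) conj≡0
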